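{- Let $p$ be the mesh pattern $(12,R)$ with $R=\{(0,0),(0,1),(0,2),(1,0),(2,0)\}$, let $E(t,u)=\sum_{n\ge0}t^n\sum_{\sigma\in K_n}u^{p(\sigma)}$, and let $P(t)=\sum_{n\ge0}|K_n(p)|t^n$. Then $$P(t)=t+\frac{A(t)}{1+t},\qquad E(t,u)=\frac{A(t)}{1+t}+\frac{tA(ut)}{1+ut}.$$ The initial terms of $E(t,u)$ are $1+t+2t^4+(12+2u^4)t^5+(78+12u^5)t^6+(568+78u^6)t^7+(4674+568u^7)t^8+\cdots$.
   Context: A permutation $\sigma=\sigma_1\cdots\sigma_n$ of $\{1,\dots,n\}$ is a king permutation if $|\sigma_{i+1}-\sigma_i|>1$ for all $1\le i\le n-1$. $K_n$ is the set of king permutations of length $n$ ($K_0$ = the empty permutation, $K_1=\{1\}$) and $A(t)=\sum_{n\ge0}|K_n|t^n$ (known to equal $\sum_{n\ge0}n!\,t^n(1-t)^n/(1+t)^n$). For a mesh pattern $p=(12,R)$ with $R\subseteq\{0,1,2\}^2$, an occurrence of $p$ in $\sigma\in S_n$ is a pair of positions $i_1<i_2$ with $\sigma_{i_1}<\sigma_{i_2}$ such that for every $(x,y)\in R$ there is no position $m$ with $i_x<m<i_{x+1}$ and $v_y<\sigma_m<v_{y+1}$, where $i_0=0$, $i_3=n+1$, $v_0=0$, $v_1=\sigma_{i_1}$, $v_2=\sigma_{i_2}$, $v_3=n+1$ (first coordinate of a box indexes positions, second values). $p(\sigma)$ is the number of occurrences of $p$ in $\sigma$; $K_n(p)$ is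 the set of king $n$-permutations with $p(\sigma)=0$. -}

module Defs where

open import Data.Nat using (ℕ; zero; suc; _∸_; _≡ᵇ_; _<ᵇ_; ∣_-_∣)
open import Data.Bool using (Bool; true; false; _∧_; not; if_then_else_)
open import Data.List using (List; []; _∷_; [_]; map; concatMap; upTo; filterᵇ; length)
open import Data.Bool.ListAction using (all; any)
open import Data.Nat.ListAction using (sum)
open import Data.Product using (_×_; _,_)
open import Data.Integer as ℤ using (ℤ; +_; -_)

-- Permutations of {1,…,n} as lists of length n (one-line notation)

range : ℕ → List ℕ
range n = map suc (upTo n)

words : ℕ → ℕ → List (List ℕ)
words zero    n = [ [] ]
words (suc k) n = concatMap (λ w → map (λ a → a ∷ w) (range n)) (words k n)

distinct : List ℕ → Bool
distinct []       = true
distinct (x ∷ xs) = not (any (λ y → x ≡ᵇ y) xs) ∧ distinct xs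

perms : ℕ → List (List ℕ)
perms n = filterᵇ distinct (words n n)

isKing : List ℕ → Bool
isKing []               = true
isKing (x ∷ [])         = true
isKing (x ∷ y ∷ xs)     = (1 <ᵇ ∣ x - y ∣) ∧ isKing (y ∷ xs)

kings : ℕ → List (List ℕ)
kings n = filterᵇ isKing (perms n)

-- σ_i (1-indexed); 0 outside 1..length
at : List ℕ → ℕ → ℕ
at []       _             = 0
at (x ∷ xs) zero          = 0
at (x ∷ xs) (suc zero)    = x
at (x ∷ xs) (suc (suc i)) = at xs (suc i)

_<ᵇ'_<ᵇ_ : ℕ → ℕ → ℕ → Bool
a <ᵇ' m <ᵇ b = (a <ᵇ m) ∧ (m <ᵇ b)

-- boundaries i_0 = 0, i_1, i_2, i_3 = N+1 (used for both positions and values)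
bnd : ℕ → ℕ → ℕ → ℕ → ℕ
bnd a b N zero                   = 0
bnd a b N (suc zero)             = a
bnd a b N (suc (suc zero))       = b
bnd a b N (suc (suc (suc _)))    = suc N

boxEmpty : List ℕ → ℕ → ℕ → ℕ × ℕ → Bool
boxEmpty σ i₁ i₂ (x , y) =
  not (any (λ m → (bnd i₁ i₂ n x <ᵇ' m <ᵇ bnd i₁ i₂ n (suc x))
                ∧ (bnd v₁ v₂ n y <ᵇ' at σ m <ᵇ bnd v₁ v₂ n (suc y)))
           (range n))
  where
    n = length σ
    v₁ = at σ i₁
    v₂ = at σ i₂

isOcc : List (ℕ × ℕ) → List ℕ → ℕ → ℕ → Bool
isOcc R σ i₁ i₂ = (i₁ <ᵇ i₂) ∧ (at σ i₁ <ᵇ at σ i₂) ∧ all (boxEmpty σ i₁ i₂) R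

count : {A : Set} → (A → Bool) → List A → ℕ
count p xs = length (filterᵇ p xs)

occurrences : List (ℕ × ℕ) → List ℕ → ℕ
occurrences R σ =
  sum (map (λ i₁ → count (λ i₂ → isOcc R σ i₁ i₂) (range n)) (range n))
  where n = length σ

meshR : List (ℕ × ℕ)
meshR = (0 , 0) ∷ (0 , 1) ∷ (0 , 2) ∷ (1 , 0) ∷ (2 , 0) ∷ []

pocc : List ℕ → ℕ
pocc = occurrences meshR

Series : Set
Series = ℕ → ℤ

Series2 : Set
Series2 = ℕ → ℕ → ℤ     -- F n k = [t^n u^k] F

sumTo : ℕ → (ℕ → ℤ) → ℤ
sumTo zero    f = f 0
sumTo (suc n) f = sumTo n f ℤ.+ f (suc n)

_⊕_ : Series → Series → Series
(f ⊕ g) n = f n ℤ.+ g n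

_⊛_ : Series → Series → Series
(f ⊛ g) n = sumTo n (λ i → f i ℤ.* g (n ∸ i))

_⊕₂_ : Series2 → Series2 → Series2
(F ⊕₂ G) n k = F n k ℤ.+ G n k

_⊛₂_ : Series2 → Series2 → Series2
(F ⊛₂ G) n k = sumTo n (λ i → sumTo k (λ j → F i j ℤ.* G (n ∸ i) (k ∸ j)))

tS : Series
tS (suc zero) = + 1
tS _          = + 0

-- 1/(1+t) = Σ (-1)^n t^n
inv1+t : Series
inv1+t n = if evenᵇ n then + 1 else - (+ 1)
  where
    evenᵇ : ℕ → Bool
    evenᵇ zero          = true
    evenᵇ (suc zero)    = false
    evenᵇ (suc (suc m)) = evenᵇ m

lift : Series → Series2
lift f n k = if k ≡ᵇ 0 then f n else + 0

-- f(ut)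
subst-ut : Series → Series2
subst-ut f n k = if k ≡ᵇ n then f n else + 0

A : Series
A n = + length (kings n)

P : Series
P n = + count (λ σ → pocc σ ≡ᵇ 0) (kings n)

E : Series2
E n k = + count (λ σ → pocc σ ≡ᵇ k) (kings n)

-- A mesh occurrence (i₁, i₂) of p has the whole first column and the whole bottom row of its
-- diagram shaded, so every other point of σ lies to the right of i₁ and above σ(i₁).  In a
-- permutation this forces i₁ = 1 and σ(1) = 1, and conversely if σ(1) = 1 then every pair (1, i₂)
-- is an occurrence.  Hence p(σ) = n - 1 when σ starts with 1 and p(σ) = 0 otherwise.
-- Removing a leading 1 and lowering the remaining entries by one maps the king permutations of
-- length n + 1 that start with 1 bijectively onto the king permutations of length n that do not
-- (the king condition at the first step says exactly σ(2) ≠ 2).  So if b n and c n count the king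
-- n-permutations starting resp. not starting with 1, then b (n + 1) = c n and b n + c n = |K n|,
-- i.e. C(t) = A(t)/(1+t), E(t,u) = C(t) + t C(ut) and P(t) = E(t,0).
module Submission where

open import Defs
open import Data.Bool using (Bool; true; false; T; _∧_; not; if_then_else_)
open import Data.Bool.ListAction using (any; or)
open import Data.Bool.Properties using (∧-zeroʳ; ∧-identityʳ; T-∧; T-∨; T-≡)
open import Data.Empty using (⊥-elim)
open import Data.Integer as ℤ using (ℤ; +_; -_; 0ℤ)
import Data.Integer.Properties as ℤP
open import Data.List using (List; []; _∷_; map; concatMap; upTo; filter; filterᵇ; length; _++_)
open import Data.List.Membership.Propositional using (_∈_; _∉_)
open import Data.List.Membership.Propositional.Properties using (∈-filter⁺; ∈-map⁺; ∈-upTo⁺)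
open import Data.List.Properties
  using (map-++; map-upTo; map-∘; length-map; length-upTo; filter-all; filter-none; filter-notAll)
open import Data.List.Relation.Unary.All as All using (All; []; _∷_)
open import Data.List.Relation.Unary.All.Properties
  using (map⁺; concat⁺; all-upTo; filter⁺; all-filter; ¬Any⇒All¬; all⁺; all⁻)
open import Data.List.Relation.Unary.Any as Any using (here; there)
open import Data.List.Relation.Unary.Any.Properties using (any⁺; any⁻)
open import Data.Nat using (ℕ; zero; suc; _+_; _∸_; _≡ᵇ_; _<ᵇ_; _≤_; _<_; z≤n; s≤s; ∣_-_∣; _≟_)
open import Data.Nat.ListAction using (sum)
open import Data.Nat.ListAction.Properties using (sum-++)
open import Data.Nat.Properties
  using ( ≤-refl; ≤-reflexive; ≤-trans; <-trans; <-irrefl; <⇒≤; <⇒≢; <⇒≱; ≤∧≢⇒<; <-cmp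
        ; m≤n⇒m≤1+n; m≤n⇒m<n∨m≡n; ≡⇒≡ᵇ; ≡ᵇ⇒≡; <⇒<ᵇ; <ᵇ⇒<
        ; +-suc; +-identityʳ; +-commutativeSemigroup; +-∸-assoc; n∸n≡0; ∸-cancelʳ-≡ )
open import Data.Product using (_×_; _,_; proj₁; proj₂; ∃-syntax)
open import Data.Sum using (inj₁; inj₂)
open import Function using (_∘_; Equivalence)
open import Relation.Binary using (tri<; tri≈; tri>)
open import Relation.Binary.PropositionalEquality
open import Relation.Nullary using (¬_; yes; no; ¬?)
open import Relation.Nullary.Decidable using (T?; dec-true; dec-false)
open import Data.List.Membership.DecPropositional _≟_ using (_∈?_)
open import Algebra.Properties.AbelianGroup ℤP.+-0-abelianGroup using (∙-cancelˡ)
open import Algebra.Properties.CommutativeSemigroup +-commutativeSemigroup using (interchange)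

≡ᵇ-refl : ∀ n → (n ≡ᵇ n) ≡ true
≡ᵇ-refl n = dec-true (n ≟ n) refl

≢⇒≡ᵇ-false : ∀ {m n} → m ≢ n → (m ≡ᵇ n) ≡ false
≢⇒≡ᵇ-false {m} {n} = dec-false (m ≟ n)

≡ᵇ-sym : ∀ m n → (m ≡ᵇ n) ≡ (n ≡ᵇ m)
≡ᵇ-sym zero    zero    = refl
≡ᵇ-sym zero    (suc n) = refl
≡ᵇ-sym (suc m) zero    = refl
≡ᵇ-sym (suc m) (suc n) = ≡ᵇ-sym m n

T-not⇒¬T : ∀ {b} → T (not b) → ¬ T b
T-not⇒¬T {false} _ ()

¬T⇒T-not : ∀ {b} → ¬ T b → T (not b)
¬T⇒T-not {true}  ¬tt = ¬tt _
¬T⇒T-not {false} _   = _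

T-ext : ∀ {a b} → (T a → T b) → (T b → T a) → a ≡ b
T-ext {true}  {true}  _ _ = refl
T-ext {true}  {false} f _ = ⊥-elim (f _)
T-ext {false} {true}  _ g = ⊥-elim (g _)
T-ext {false} {false} _ _ = refl

sumTo-cong : ∀ n {f g : ℕ → ℤ} → (∀ {i} → i ≤ n → f i ≡ g i) → sumTo n f ≡ sumTo n g
sumTo-cong zero    f≗g = f≗g z≤n
sumTo-cong (suc n) f≗g = cong₂ ℤ._+_ (sumTo-cong n (f≗g ∘ m≤n⇒m≤1+n)) (f≗g ≤-refl)

sumTo-zero : ∀ n {f : ℕ → ℤ} → (∀ {i} → i ≤ n → f i ≡ 0ℤ) → sumTo n f ≡ 0ℤ
sumTo-zero zero    f≗0 = f≗0 z≤n
sumTo-zero (suc n) f≗0 = cong₂ ℤ._+_ (sumTo-zero n (f≗0 ∘ m≤n⇒m≤1+n)) (f≗0 ≤-refl)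

sumTo-suc : ∀ n (f : ℕ → ℤ) → sumTo (suc n) f ≡ f 0 ℤ.+ sumTo n (f ∘ suc)
sumTo-suc zero    f = refl
sumTo-suc (suc n) f = begin
  sumTo (suc n) f ℤ.+ f (suc (suc n))                 ≡⟨ cong (ℤ._+ f (suc (suc n))) (sumTo-suc n f) ⟩
  f 0 ℤ.+ sumTo n (f ∘ suc) ℤ.+ f (suc (suc n))       ≡⟨ ℤP.+-assoc (f 0) _ _ ⟩
  f 0 ℤ.+ sumTo (suc n) (f ∘ suc)                     ∎
  where open ≡-Reasoning

sumTo-head : ∀ n (f : ℕ → ℤ) → (∀ i → f (suc i) ≡ 0ℤ) → sumTo n f ≡ f 0
sumTo-head zero    f tail≗0 = refl
sumTo-head (suc n) f tail≗0 =
  trans (cong₂ ℤ._+_ (sumTo-head n f tail≗0) (tail≗0 n)) (ℤP.+-identityʳ (f 0))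

sumTo-neg : ∀ n (f : ℕ → ℤ) → sumTo n (λ i → - f i) ≡ - sumTo n f
sumTo-neg zero    f = refl
sumTo-neg (suc n) f = begin
  sumTo n (λ i → - f i) ℤ.+ - f (suc n)  ≡⟨ cong (ℤ._+ - f (suc n)) (sumTo-neg n f) ⟩
  - sumTo n f ℤ.+ - f (suc n)            ≡⟨ ℤP.neg-distrib-+ (sumTo n f) (f (suc n)) ⟨
  - sumTo (suc n) f                      ∎
  where open ≡-Reasoning

kronecker-≢ : ∀ i j (c x : ℤ) → j ≢ i → (if j ≡ᵇ i then c else 0ℤ) ℤ.* x ≡ 0ℤ
kronecker-≢ i j c x j≢i rewrite ≢⇒≡ᵇ-false j≢i = refl

sumTo-kronecker : ∀ k {i} (c : ℤ) (h : ℕ → ℤ) → i ≤ k →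
                  sumTo k (λ j → (if j ≡ᵇ i then c else 0ℤ) ℤ.* h j) ≡ c ℤ.* h i
sumTo-kronecker zero    c h z≤n = refl
sumTo-kronecker (suc k) {i} c h i≤1+k with m≤n⇒m<n∨m≡n i≤1+k
... | inj₁ (s≤s i≤k) = begin
  sumTo k _ ℤ.+ (if suc k ≡ᵇ i then c else 0ℤ) ℤ.* h (suc k)
    ≡⟨ cong₂ ℤ._+_ (sumTo-kronecker k c h i≤k) (kronecker-≢ i (suc k) c _ (λ { refl → <-irrefl refl (s≤s i≤k) })) ⟩
  c ℤ.* h i ℤ.+ 0ℤ
    ≡⟨ ℤP.+-identityʳ _ ⟩
  c ℤ.* h i ∎
  where open ≡-Reasoning
... | inj₂ refl = begin
  sumTo k _ ℤ.+ (if suc k ≡ᵇ suc k then c else 0ℤ) ℤ.* h (suc k)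
    ≡⟨ cong₂ ℤ._+_ (sumTo-zero k (λ {j} j≤k → kronecker-≢ (suc k) j c _ (λ { refl → <-irrefl refl (s≤s j≤k) })))
                   (cong (λ b → (if b then c else 0ℤ) ℤ.* h (suc k)) (≡ᵇ-refl (suc k))) ⟩
  0ℤ ℤ.+ c ℤ.* h (suc k)
    ≡⟨ ℤP.+-identityˡ _ ⟩
  c ℤ.* h (suc k) ∎
  where open ≡-Reasoning

inv1+t-suc : ∀ n → inv1+t (suc n) ≡ - inv1+t n
inv1+t-suc zero          = refl
inv1+t-suc (suc zero)    = refl
inv1+t-suc (suc (suc n)) = inv1+t-suc n

⊛-inv1+t-suc : ∀ (f : Series) n → (f ⊛ inv1+t) (suc n) ≡ - (f ⊛ inv1+t) n ℤ.+ f (suc n)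
⊛-inv1+t-suc f n = cong₂ ℤ._+_ lower-terms top-term
  where
  open ≡-Reasoning
  lower-terms : sumTo n (λ i → f i ℤ.* inv1+t (suc n ∸ i)) ≡ - (f ⊛ inv1+t) n
  lower-terms = begin
    sumTo n (λ i → f i ℤ.* inv1+t (suc n ∸ i))
      ≡⟨ sumTo-cong n (λ {i} i≤n → begin
           f i ℤ.* inv1+t (suc n ∸ i)   ≡⟨ cong (λ m → f i ℤ.* inv1+t m) (+-∸-assoc 1 i≤n) ⟩
           f i ℤ.* inv1+t (suc (n ∸ i)) ≡⟨ cong (f i ℤ.*_) (inv1+t-suc (n ∸ i)) ⟩
           f i ℤ.* - inv1+t (n ∸ i)     ≡⟨ ℤP.neg-distribʳ-* (f i) (inv1+t (n ∸ i)) ⟨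
           - (f i ℤ.* inv1+t (n ∸ i))   ∎) ⟩
    sumTo n (λ i → - (f i ℤ.* inv1+t (n ∸ i)))
      ≡⟨ sumTo-neg n _ ⟩
    - (f ⊛ inv1+t) n ∎
  top-term : f (suc n) ℤ.* inv1+t (suc n ∸ suc n) ≡ f (suc n)
  top-term = trans (cong (λ m → f (suc n) ℤ.* inv1+t m) (n∸n≡0 n)) (ℤP.*-identityʳ (f (suc n)))

⊛-inv1+t-unique : ∀ (c f : Series) → c 0 ≡ f 0 → (∀ n → c n ℤ.+ c (suc n) ≡ f (suc n)) →
                  ∀ n → c n ≡ (f ⊛ inv1+t) n
⊛-inv1+t-unique c f c₀≡f₀ c[1+t]≡f zero    = trans c₀≡f₀ (sym (ℤP.*-identityʳ (f 0)))
⊛-inv1+t-unique c f c₀≡f₀ c[1+t]≡f (suc n) = ∙-cancelˡ (c n) _ _ (begin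
  c n ℤ.+ c (suc n)                                  ≡⟨ c[1+t]≡f n ⟩
  f (suc n)                                          ≡⟨ ℤP.+-identityˡ (f (suc n)) ⟨
  0ℤ ℤ.+ f (suc n)                                   ≡⟨ cong (ℤ._+ f (suc n)) (ℤP.+-inverseʳ (c n)) ⟨
  c n ℤ.+ - c n ℤ.+ f (suc n)                        ≡⟨ ℤP.+-assoc (c n) (- c n) (f (suc n)) ⟩
  c n ℤ.+ (- c n ℤ.+ f (suc n))                      ≡⟨ cong (λ x → c n ℤ.+ (- x ℤ.+ f (suc n))) (⊛-inv1+t-unique c f c₀≡f₀ c[1+t]≡f n) ⟩
  c n ℤ.+ (- (f ⊛ inv1+t) n ℤ.+ f (suc n))           ≡⟨ cong (λ x → c n ℤ.+ x) (⊛-inv1+t-suc f n) ⟨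
  c n ℤ.+ (f ⊛ inv1+t) (suc n)                       ∎)
  where open ≡-Reasoning

lift-tS-⊛₂-zero : ∀ (F : Series2) k → (lift tS ⊛₂ F) 0 k ≡ 0ℤ
lift-tS-⊛₂-zero F k = sumTo-zero k λ { {zero} _ → refl ; {suc _} _ → refl }

lift-tS-⊛₂-suc : ∀ (F : Series2) n k → (lift tS ⊛₂ F) (suc n) k ≡ F n k
lift-tS-⊛₂-suc F n k = begin
  (lift tS ⊛₂ F) (suc n) k
    ≡⟨ sumTo-cong (suc n) (λ {a} _ → sumTo-head k _ (λ _ → refl)) ⟩
  sumTo (suc n) (λ a → tS a ℤ.* F (suc n ∸ a) k)
    ≡⟨ sumTo-suc n _ ⟩
  0ℤ ℤ.+ sumTo n (λ a → tS (suc a) ℤ.* F (n ∸ a) k)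
    ≡⟨ ℤP.+-identityˡ _ ⟩
  sumTo n (λ a → tS (suc a) ℤ.* F (n ∸ a) k)
    ≡⟨ sumTo-head n _ (λ _ → refl) ⟩
  + 1 ℤ.* F n k
    ≡⟨ ℤP.*-identityˡ (F n k) ⟩
  F n k ∎
  where open ≡-Reasoning

lift-tS-⊛₂-⊛₂-zero : ∀ (F H : Series2) k → ((lift tS ⊛₂ F) ⊛₂ H) 0 k ≡ 0ℤ
lift-tS-⊛₂-⊛₂-zero F H k = sumTo-zero k (λ {j} _ → cong (ℤ._* H 0 (k ∸ j)) (lift-tS-⊛₂-zero F j))

lift-tS-⊛₂-⊛₂-suc : ∀ (F H : Series2) n k → ((lift tS ⊛₂ F) ⊛₂ H) (suc n) k ≡ (F ⊛₂ H) n k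
lift-tS-⊛₂-⊛₂-suc F H n k = begin
  ((lift tS ⊛₂ F) ⊛₂ H) (suc n) k
    ≡⟨ sumTo-suc n _ ⟩
  ((lift tS ⊛₂ F) ⊛₂ (λ _ → H (suc n))) 0 k ℤ.+ shifted
    ≡⟨ cong (ℤ._+ shifted) (lift-tS-⊛₂-⊛₂-zero F (λ _ → H (suc n)) k) ⟩
  0ℤ ℤ.+ shifted
    ≡⟨ ℤP.+-identityˡ shifted ⟩
  shifted
    ≡⟨ sumTo-cong n (λ {i} _ → sumTo-cong k (λ {j} _ → cong (ℤ._* H (n ∸ i) (k ∸ j)) (lift-tS-⊛₂-suc F i j))) ⟩
  (F ⊛₂ H) n k ∎
  where
  open ≡-Reasoning
  shifted : ℤ
  shifted = sumTo n (λ i → sumTo k (λ j → (lift tS ⊛₂ F) (suc i) j ℤ.* H (n ∸ i) (k ∸ j)))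

subst-ut-⊛₂ : ∀ (f g : Series) n k → (subst-ut f ⊛₂ subst-ut g) n k ≡ subst-ut (f ⊛ g) n k
subst-ut-⊛₂ f g n k with k ≟ n
... | yes refl = begin
  (subst-ut f ⊛₂ subst-ut g) n n
    ≡⟨ sumTo-cong n (λ {i} → diagonal i) ⟩
  (f ⊛ g) n
    ≡⟨ cong (λ b → if b then (f ⊛ g) n else 0ℤ) (≡ᵇ-refl n) ⟨
  subst-ut (f ⊛ g) n n ∎
  where
  open ≡-Reasoning
  diagonal : ∀ i → i ≤ n → sumTo n (λ j → subst-ut f i j ℤ.* subst-ut g (n ∸ i) (n ∸ j)) ≡ f i ℤ.* g (n ∸ i)
  diagonal i i≤n = trans (sumTo-kronecker n (f i) (λ j → subst-ut g (n ∸ i) (n ∸ j)) i≤n)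
                         (cong (λ b → f i ℤ.* (if b then g (n ∸ i) else 0ℤ)) (≡ᵇ-refl (n ∸ i)))
... | no k≢n = begin
  (subst-ut f ⊛₂ subst-ut g) n k
    ≡⟨ sumTo-zero n (λ {i} i≤n → sumTo-zero k (λ {j} → off-diagonal i j i≤n)) ⟩
  0ℤ
    ≡⟨ cong (λ b → if b then (f ⊛ g) n else 0ℤ) (≢⇒≡ᵇ-false k≢n) ⟨
  subst-ut (f ⊛ g) n k ∎
  where
  open ≡-Reasoning
  off-diagonal : ∀ i j → i ≤ n → j ≤ k → subst-ut f i j ℤ.* subst-ut g (n ∸ i) (k ∸ j) ≡ 0ℤ
  off-diagonal i j i≤n j≤k with j ≟ i
  ... | no j≢i   = kronecker-≢ i j (f i) _ j≢i
  ... | yes refl rewrite ≢⇒≡ᵇ-false (k≢n ∘ ∸-cancelʳ-≡ j≤k i≤n) = ℤP.*-zeroʳ (subst-ut f j j)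

indicator : Bool → ℕ
indicator b = if b then 1 else 0

indicator-if : ∀ c a b → indicator (if c then a else b)
                          ≡ (if a then indicator c else 0) + (if b then indicator (not c) else 0)
indicator-if true  true  true  = refl
indicator-if true  true  false = refl
indicator-if true  false true  = refl
indicator-if true  false false = refl
indicator-if false true  true  = refl
indicator-if false true  false = refl
indicator-if false false true  = refl
indicator-if false false false = refl

module _ {A : Set} where

  sum-map-cong : ∀ {f g : A → ℕ} {xs} → All (λ x → f x ≡ g x) xs → sum (map f xs) ≡ sum (map g xs)
  sum-map-cong []            = refl
  sum-map-cong (fx≡gx ∷ eqs) = cong₂ _+_ fx≡gx (sum-map-cong eqs)

  sum-map-zero : ∀ {f : A → ℕ} {xs} → All (λ x → f x ≡ 0) xs → sum (map f xs) ≡ 0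
  sum-map-zero []            = refl
  sum-map-zero (fx≡0 ∷ eqs) = cong₂ _+_ fx≡0 (sum-map-zero eqs)

  sum-map-+ : ∀ (f g : A → ℕ) xs → sum (map (λ x → f x + g x) xs) ≡ sum (map f xs) + sum (map g xs)
  sum-map-+ f g []       = refl
  sum-map-+ f g (x ∷ xs) =
    trans (cong (λ s → f x + g x + s) (sum-map-+ f g xs)) (interchange (f x) (g x) _ _)

  sum-map-concatMap : ∀ {B : Set} (f : B → ℕ) (g : A → List B) xs →
                      sum (map f (concatMap g xs)) ≡ sum (map (λ x → sum (map f (g x))) xs)
  sum-map-concatMap f g []       = refl
  sum-map-concatMap f g (x ∷ xs) = begin
    sum (map f (g x ++ concatMap g xs))                ≡⟨ cong sum (map-++ f (g x) (concatMap g xs)) ⟩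
    sum (map f (g x) ++ map f (concatMap g xs))        ≡⟨ sum-++ (map f (g x)) _ ⟩
    sum (map f (g x)) + sum (map f (concatMap g xs))   ≡⟨ cong (λ s → sum (map f (g x)) + s) (sum-map-concatMap f g xs) ⟩
    sum (map (λ x → sum (map f (g x))) (x ∷ xs))       ∎
    where open ≡-Reasoning

  sum-map-∘ : ∀ {B : Set} (f : B → ℕ) (g : A → B) xs → sum (map f (map g xs)) ≡ sum (map (f ∘ g) xs)
  sum-map-∘ f g xs = cong sum (sym (map-∘ xs))

  count-as-sum : ∀ (p : A → Bool) xs → count p xs ≡ sum (map (indicator ∘ p) xs)
  count-as-sum p []       = refl
  count-as-sum p (x ∷ xs) with p x
  ... | true  = cong suc (count-as-sum p xs)
  ... | false = count-as-sum p xs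

  count-all : ∀ {p : A → Bool} {xs} → All (T ∘ p) xs → count p xs ≡ length xs
  count-all {p} = cong length ∘ filter-all (T? ∘ p)

  count-none : ∀ (p : A → Bool) {xs} → All (¬_ ∘ T ∘ p) xs → count p xs ≡ 0
  count-none p = cong length ∘ filter-none (T? ∘ p)

  count-cong : ∀ {p q : A → Bool} {xs} → All (λ x → p x ≡ q x) xs → count p xs ≡ count q xs
  count-cong {p} {q} {xs} eqs = begin
    count p xs                    ≡⟨ count-as-sum p xs ⟩
    sum (map (indicator ∘ p) xs)  ≡⟨ sum-map-cong (All.map (cong indicator) eqs) ⟩
    sum (map (indicator ∘ q) xs)  ≡⟨ count-as-sum q xs ⟨
    count q xs                    ∎
    where open ≡-Reasoning

  count-filterᵇ : ∀ (p q : A → Bool) xs → count p (filterᵇ q xs) ≡ count (λ x → q x ∧ p x) xs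
  count-filterᵇ p q []       = refl
  count-filterᵇ p q (x ∷ xs) with q x
  ... | false = count-filterᵇ p q xs
  ... | true with p x
  ...   | true  = cong suc (count-filterᵇ p q xs)
  ...   | false = count-filterᵇ p q xs

  count-complement : ∀ (p : A → Bool) xs → count p xs + count (not ∘ p) xs ≡ length xs
  count-complement p []       = refl
  count-complement p (x ∷ xs) with p x
  ... | true  = cong suc (count-complement p xs)
  ... | false = trans (+-suc _ _) (cong suc (count-complement p xs))

  count-if : ∀ (h : A → Bool) (a b : Bool) xs →
             count (λ x → if h x then a else b) xs
               ≡ (if a then count h xs else 0) + (if b then count (not ∘ h) xs else 0)
  count-if h a b xs = begin
    count (λ x → if h x then a else b) xs
      ≡⟨ count-as-sum _ xs ⟩
    sum (map (λ x → indicator (if h x then a else b)) xs)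
      ≡⟨ sum-map-cong (All.universal (λ x → indicator-if (h x) a b) xs) ⟩
    sum (map (λ x → (if a then indicator (h x) else 0) + (if b then indicator (not (h x)) else 0)) xs)
      ≡⟨ sum-map-+ _ _ xs ⟩
    sum (map (λ x → if a then indicator (h x) else 0) xs) + sum (map (λ x → if b then indicator (not (h x)) else 0) xs)
      ≡⟨ cong₂ _+_ (sum-map-if a h) (sum-map-if b (not ∘ h)) ⟩
    (if a then count h xs else 0) + (if b then count (not ∘ h) xs else 0) ∎
    where
    open ≡-Reasoning
    sum-map-if : ∀ c (p : A → Bool) → sum (map (λ x → if c then indicator (p x) else 0) xs) ≡ (if c then count p xs else 0)
    sum-map-if true  p = sym (count-as-sum p xs)
    sum-map-if false p = sum-map-zero (All.universal (λ _ → refl) xs)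

InRange : ℕ → ℕ → Set
InRange m a = 1 ≤ a × a ≤ m

range-suc : ∀ m → range (suc m) ≡ 1 ∷ map suc (range m)
range-suc m = cong (λ xs → 1 ∷ map suc xs) (sym (map-upTo suc m))

range-inRange : ∀ m → All (InRange m) (range m)
range-inRange m = map⁺ (All.map (λ i<m → s≤s z≤n , i<m) (all-upTo m))

length-range : ∀ m → length (range m) ≡ m
length-range m = trans (length-map suc (upTo m)) (length-upTo m)

inRange⇒∈range : ∀ {m a} → InRange m a → a ∈ range m
inRange⇒∈range {a = suc a} (_ , a<m) = ∈-map⁺ suc (∈-upTo⁺ a<m)

words-inRange : ∀ k m → All (λ w → length w ≡ k × All (InRange m) w) (words k m)
words-inRange zero    m = (refl , []) ∷ []
words-inRange (suc k) m = concat⁺ (map⁺ (All.map prepend (words-inRange k m)))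
  where
  prepend : ∀ {w} → length w ≡ k × All (InRange m) w →
            All (λ v → length v ≡ suc k × All (InRange m) v) (map (_∷ w) (range m))
  prepend (refl , w-inRange) = map⁺ (All.map (λ a-inRange → refl , a-inRange ∷ w-inRange) (range-inRange m))

record IsPerm (σ : List ℕ) : Set where
  field
    inRange    : All (InRange (length σ)) σ
    isDistinct : T (distinct σ)

kings-isPerm : ∀ n → All (λ σ → length σ ≡ n × IsPerm σ) (kings n)
kings-isPerm n = filter⁺ (T? ∘ isKing) (All.zipWith toPerm
  (filter⁺ (T? ∘ distinct) (words-inRange n n) , all-filter (T? ∘ distinct) (words n n)))
  where
  toPerm : ∀ {σ} → (length σ ≡ n × All (InRange n) σ) × T (distinct σ) → length σ ≡ n × IsPerm σ
  toPerm {σ} ((len , inR) , dist) =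
    len , record { inRange = subst (λ m → All (InRange m) σ) (sym len) inR ; isDistinct = dist }

count-kings : ∀ n (p : List ℕ → Bool) →
              count p (kings n) ≡ count (λ w → distinct w ∧ (isKing w ∧ p w)) (words n n)
count-kings n p = trans (count-filterᵇ p isKing (perms n))
                        (count-filterᵇ (λ w → isKing w ∧ p w) distinct (words n n))

-- Words over {1, …, m + 1} avoiding the letter 1 are exactly the words map suc w with w over {1, …, m}.
sum-words-suc : ∀ k m (f : List ℕ → ℕ) → (∀ w → T (any (1 ≡ᵇ_) w) → f w ≡ 0) →
                sum (map f (words k (suc m))) ≡ sum (map (f ∘ map suc) (words k m))
sum-words-suc zero    m f f-vanishes = refl
sum-words-suc (suc k) m f f-vanishes = begin
  sum (map f (words (suc k) (suc m)))
    ≡⟨ sum-map-concatMap f (λ w → map (_∷ w) (range (suc m))) (words k (suc m)) ⟩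
  sum (map (λ w → sum (map f (map (_∷ w) (range (suc m))))) (words k (suc m)))
    ≡⟨ sum-words-suc k m _ extensions-vanish ⟩
  sum (map (λ w → sum (map f (map (_∷ map suc w) (range (suc m))))) (words k m))
    ≡⟨ sum-map-cong (All.universal first-letter-one (words k m)) ⟩
  sum (map (λ w → sum (map (f ∘ map suc) (map (_∷ w) (range m)))) (words k m))
    ≡⟨ sum-map-concatMap (f ∘ map suc) (λ w → map (_∷ w) (range m)) (words k m) ⟨
  sum (map (f ∘ map suc) (words (suc k) m)) ∎
  where
  open ≡-Reasoning
  extensions-vanish : ∀ w → T (any (1 ≡ᵇ_) w) → sum (map f (map (_∷ w) (range (suc m)))) ≡ 0
  extensions-vanish w 1∈w = sum-map-zero (map⁺ (All.universal (λ a → f-vanishes (a ∷ w) (Equivalence.from T-∨ (inj₂ 1∈w))) (range (suc m))))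
  first-letter-one : ∀ w → sum (map f (map (_∷ map suc w) (range (suc m))))
                           ≡ sum (map (f ∘ map suc) (map (_∷ w) (range m)))
  first-letter-one w = begin
    sum (map f (map (_∷ map suc w) (range (suc m))))
      ≡⟨ cong (λ r → sum (map f (map (_∷ map suc w) r))) (range-suc m) ⟩
    f (1 ∷ map suc w) + sum (map f (map (_∷ map suc w) (map suc (range m))))
      ≡⟨ cong₂ _+_ (f-vanishes (1 ∷ map suc w) _) (sum-map-∘ f _ (map suc (range m))) ⟩
    sum (map (λ a → f (a ∷ map suc w)) (map suc (range m)))
      ≡⟨ sum-map-∘ _ suc (range m) ⟩
    sum (map (λ a → f (suc a ∷ map suc w)) (range m))
      ≡⟨ sum-map-∘ (f ∘ map suc) _ (range m) ⟨
    sum (map (f ∘ map suc) (map (_∷ w) (range m))) ∎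

∈⇒T-any-≡ᵇ : ∀ {x xs} → x ∈ xs → T (any (x ≡ᵇ_) xs)
∈⇒T-any-≡ᵇ {x} = any⁺ (x ≡ᵇ_) ∘ Any.map (≡⇒≡ᵇ x _)

distinct-head : ∀ {x xs} → T (distinct (x ∷ xs)) → x ∉ xs
distinct-head d = T-not⇒¬T (proj₁ (Equivalence.to T-∧ d)) ∘ ∈⇒T-any-≡ᵇ

distinct-tail : ∀ {x xs} → T (distinct (x ∷ xs)) → T (distinct xs)
distinct-tail d = proj₂ (Equivalence.to T-∧ d)

distinct-length≤ : ∀ {xs ys : List ℕ} → T (distinct xs) → All (_∈ ys) xs → length xs ≤ length ys
distinct-length≤ {[]}     _ _                 = z≤n
distinct-length≤ {x ∷ xs} {ys} d (x∈ys ∷ xs⊆ys) =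
  ≤-trans (s≤s (distinct-length≤ (distinct-tail {x} {xs} d) xs⊆ys-x))
          (filter-notAll x≢? ys (Any.map (λ x≡y x≢y → x≢y x≡y) x∈ys))
  where
  x≢? = λ y → ¬? (x ≟ y)
  xs⊆ys-x : All (_∈ filter x≢? ys) xs
  xs⊆ys-x = All.zipWith (λ (y∈ys , x≢y) → ∈-filter⁺ x≢? y∈ys x≢y)
              (xs⊆ys , ¬Any⇒All¬ xs (distinct-head {x} {xs} d))

1∈perm : ∀ {σ} → IsPerm σ → 1 ≤ length σ → 1 ∈ σ
1∈perm {x ∷ w} perm _ with 1 ∈? x ∷ w
... | yes 1∈σ = 1∈σ
... | no  1∉σ = ⊥-elim (<-irrefl refl (≤-trans too-long (≤-reflexive shorter)))
  where
  open IsPerm perm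
  L = length w
  ∈-tail : ∀ {y} → y ∈ x ∷ w → y ∈ map suc (range L)
  ∈-tail {y} y∈σ with subst (y ∈_) (range-suc L) (inRange⇒∈range (All.lookup inRange y∈σ))
  ... | here refl = ⊥-elim (1∉σ y∈σ)
  ... | there y∈ = y∈
  too-long : suc L ≤ length (map suc (range L))
  too-long = distinct-length≤ isDistinct (All.tabulate ∈-tail)
  shorter : length (map suc (range L)) ≡ L
  shorter = trans (length-map suc (range L)) (length-range L)

at-∈ : ∀ σ {m} → InRange (length σ) m → at σ m ∈ σ
at-∈ (x ∷ σ) {suc zero}    _              = here refl
at-∈ (x ∷ σ) {suc (suc m)} (_ , s≤s m≤|σ|) = there (at-∈ σ (s≤s z≤n , m≤|σ|))

∈⇒at : ∀ {σ x} → x ∈ σ → ∃[ m ] InRange (length σ) m × at σ m ≡ x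
∈⇒at (here refl)     = 1 , (s≤s z≤n , s≤s z≤n) , refl
∈⇒at {_ ∷ _} (there x∈σ) with ∈⇒at x∈σ
... | suc m , (_ , m≤|σ|) , eq = suc (suc m) , (s≤s z≤n , s≤s m≤|σ|) , eq

at-injective : ∀ σ {i j} → T (distinct σ) → InRange (length σ) i → InRange (length σ) j →
               at σ i ≡ at σ j → i ≡ j
at-injective (x ∷ σ) {suc zero}    {suc zero}    d _ _ _  = refl
at-injective (x ∷ σ) {suc zero}    {suc (suc j)} d _ (_ , s≤s j≤) eq =
  ⊥-elim (distinct-head {x} {σ} d (subst (_∈ σ) (sym eq) (at-∈ σ (s≤s z≤n , j≤))))
at-injective (x ∷ σ) {suc (suc i)} {suc zero}    d (_ , s≤s i≤) _ eq =
  ⊥-elim (distinct-head {x} {σ} d (subst (_∈ σ) eq (at-∈ σ (s≤s z≤n , i≤))))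
at-injective (x ∷ σ) {suc (suc i)} {suc (suc j)} d (_ , s≤s i≤) (_ , s≤s j≤) eq =
  cong suc (at-injective σ (distinct-tail {x} {σ} d) (s≤s z≤n , i≤) (s≤s z≤n , j≤) eq)

startsWithOne : List ℕ → Bool
startsWithOne (suc zero ∷ _) = true
startsWithOne _              = false

at-1≡1⇒startsWithOne : ∀ σ → at σ 1 ≡ 1 → T (startsWithOne σ)
at-1≡1⇒startsWithOne (suc zero ∷ _) _ = _

T-between⁺ : ∀ {a m b} → a < m → m < b → T (a <ᵇ' m <ᵇ b)
T-between⁺ a<m m<b = Equivalence.from T-∧ (<⇒<ᵇ a<m , <⇒<ᵇ m<b)

T-between⁻ : ∀ a m b → T (a <ᵇ' m <ᵇ b) → a < m × m < b
T-between⁻ a m b t with Equivalence.to T-∧ t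
... | a<ᵇm , m<ᵇb = <ᵇ⇒< a m a<ᵇm , <ᵇ⇒< m b m<ᵇb

InBox : List ℕ → ℕ → ℕ → ℕ × ℕ → ℕ → Set
InBox σ i₁ i₂ (x , y) m =
  (bnd i₁ i₂ N x < m × m < bnd i₁ i₂ N (suc x)) ×
  (bnd v₁ v₂ N y < at σ m × at σ m < bnd v₁ v₂ N (suc y))
  where
  N = length σ
  v₁ = at σ i₁
  v₂ = at σ i₂

boxEmpty-elim : ∀ σ {i₁ i₂ b m} → T (boxEmpty σ i₁ i₂ b) → InRange (length σ) m → ¬ InBox σ i₁ i₂ b m
boxEmpty-elim σ {b = x , y} empty m-inRange ((x<m , m<x') , (y<v , v<y')) =
  T-not⇒¬T empty (any⁺ _ (Any.map (λ { refl → Equivalence.from T-∧ (T-between⁺ x<m m<x' , T-between⁺ y<v v<y') })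
                                  (inRange⇒∈range m-inRange)))

boxEmpty-intro : ∀ σ i₁ i₂ b → (∀ {m} → InRange (length σ) m → ¬ InBox σ i₁ i₂ b m) → T (boxEmpty σ i₁ i₂ b)
boxEmpty-intro σ i₁ i₂ (x , y) no-point = ¬T⇒T-not λ hit →
  let m-inRange , inside = All.lookupAny (range-inRange (length σ)) (any⁻ _ _ hit)
      inside-x , inside-y = Equivalence.to T-∧ inside
  in no-point m-inRange (T-between⁻ _ _ _ inside-x , T-between⁻ _ _ _ inside-y)

isOcc-elim : ∀ R σ {i₁ i₂} → T (isOcc R σ i₁ i₂) →
             i₁ < i₂ × at σ i₁ < at σ i₂ × All (T ∘ boxEmpty σ i₁ i₂) R
isOcc-elim R σ {i₁} {i₂} occ =
  let i₁<ᵇi₂ , rest = Equivalence.to T-∧ occ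
      v₁<ᵇv₂ , empty = Equivalence.to T-∧ rest
  in <ᵇ⇒< i₁ i₂ i₁<ᵇi₂ , <ᵇ⇒< _ _ v₁<ᵇv₂ , all⁺ (boxEmpty σ i₁ i₂) R empty

isOcc-intro : ∀ R σ {i₁ i₂} → i₁ < i₂ → at σ i₁ < at σ i₂ → All (T ∘ boxEmpty σ i₁ i₂) R →
              T (isOcc R σ i₁ i₂)
isOcc-intro R σ {i₁} {i₂} i₁<i₂ v₁<v₂ empty =
  Equivalence.from T-∧ (<⇒<ᵇ i₁<i₂ , Equivalence.from T-∧ (<⇒<ᵇ v₁<v₂ , all⁻ (boxEmpty σ i₁ i₂) empty))

module _ {σ : List ℕ} (perm : IsPerm σ) {i₁ i₂ : ℕ}
         (i₁-inRange : InRange (length σ) i₁) (i₂-inRange : InRange (length σ) i₂)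
         (occ : T (isOcc meshR σ i₁ i₂)) where

  open IsPerm perm

  private
    i₁<i₂ : i₁ < i₂
    i₁<i₂ = proj₁ (isOcc-elim meshR σ occ)

    v₁<v₂ : at σ i₁ < at σ i₂
    v₁<v₂ = proj₁ (proj₂ (isOcc-elim meshR σ occ))

  occurrence-dominates : ∀ {m} → InRange (length σ) m → m ≢ i₁ → m ≢ i₂ → i₁ < m × at σ i₁ < at σ m
  occurrence-dominates {m} m-inRange m≢i₁ m≢i₂ with proj₂ (proj₂ (isOcc-elim meshR σ occ))
  ... | e00 ∷ e01 ∷ e02 ∷ e10 ∷ e20 ∷ [] = right-of-i₁ , above-v₁
    where
    v = at σ m
    v-inRange : InRange (length σ) v
    v-inRange = All.lookup inRange (at-∈ σ m-inRange)
    v≢v₁ : v ≢ at σ i₁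
    v≢v₁ = m≢i₁ ∘ at-injective σ isDistinct m-inRange i₁-inRange
    v≢v₂ : v ≢ at σ i₂
    v≢v₂ = m≢i₂ ∘ at-injective σ isDistinct m-inRange i₂-inRange
    hit : ∀ b → T (boxEmpty σ i₁ i₂ b) → ¬ InBox σ i₁ i₂ b m
    hit b empty = boxEmpty-elim σ empty m-inRange
    right-of-i₁ : i₁ < m
    right-of-i₁ with <-cmp m i₁
    ... | tri≈ _ m≡i₁ _ = ⊥-elim (m≢i₁ m≡i₁)
    ... | tri> _ _ i₁<m = i₁<m
    ... | tri< m<i₁ _ _ with <-cmp v (at σ i₁) | <-cmp v (at σ i₂)
    ...   | tri< v<v₁ _ _ | _             = ⊥-elim (hit (0 , 0) e00 ((proj₁ m-inRange , m<i₁) , (proj₁ v-inRange , v<v₁)))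
    ...   | tri≈ _ v≡v₁ _ | _             = ⊥-elim (v≢v₁ v≡v₁)
    ...   | tri> _ _ v₁<v | tri< v<v₂ _ _ = ⊥-elim (hit (0 , 1) e01 ((proj₁ m-inRange , m<i₁) , (v₁<v , v<v₂)))
    ...   | tri> _ _ _    | tri≈ _ v≡v₂ _ = ⊥-elim (v≢v₂ v≡v₂)
    ...   | tri> _ _ _    | tri> _ _ v₂<v = ⊥-elim (hit (0 , 2) e02 ((proj₁ m-inRange , m<i₁) , (v₂<v , s≤s (proj₂ v-inRange))))
    above-v₁ : at σ i₁ < v
    above-v₁ with <-cmp v (at σ i₁)
    ... | tri≈ _ v≡v₁ _ = ⊥-elim (v≢v₁ v≡v₁)
    ... | tri> _ _ v₁<v = v₁<v
    ... | tri< v<v₁ _ _ with <-cmp m i₂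
    ...   | tri< m<i₂ _ _ = ⊥-elim (hit (1 , 0) e10 ((right-of-i₁ , m<i₂) , (proj₁ v-inRange , v<v₁)))
    ...   | tri≈ _ m≡i₂ _ = ⊥-elim (m≢i₂ m≡i₂)
    ...   | tri> _ _ i₂<m = ⊥-elim (hit (2 , 0) e20 ((i₂<m , s≤s (proj₂ m-inRange)) , (proj₁ v-inRange , v<v₁)))

  occurrence⇒i₁≡1 : i₁ ≡ 1
  occurrence⇒i₁≡1 with m≤n⇒m<n∨m≡n (proj₁ i₁-inRange)
  ... | inj₂ 1≡i₁ = sym 1≡i₁
  ... | inj₁ 1<i₁ = ⊥-elim (<⇒≱ 1<i₁ (<⇒≤ i₁<1))
    where
    1-inRange : InRange (length σ) 1
    1-inRange = s≤s z≤n , ≤-trans (proj₁ i₁-inRange) (proj₂ i₁-inRange)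
    i₁<1 : i₁ < 1
    i₁<1 = proj₁ (occurrence-dominates 1-inRange (<⇒≢ 1<i₁) (<⇒≢ (<-trans 1<i₁ i₁<i₂)))

  private
    below-1 : ¬ at σ i₁ < 1
    below-1 v₁<1 = <⇒≱ v₁<1 (proj₁ (All.lookup inRange (at-∈ σ i₁-inRange)))

  occurrence⇒at-i₁≡1 : at σ i₁ ≡ 1
  occurrence⇒at-i₁≡1 with ∈⇒at (1∈perm perm (≤-trans (proj₁ i₁-inRange) (proj₂ i₁-inRange)))
  ... | m , m-inRange , at-m≡1 with m ≟ i₁ | m ≟ i₂
  ...   | yes refl | _        = at-m≡1
  ...   | no _     | yes refl = ⊥-elim (below-1 (subst (at σ i₁ <_) at-m≡1 v₁<v₂))
  ...   | no m≢i₁  | no m≢i₂  = ⊥-elim (below-1 (subst (at σ i₁ <_) at-m≡1 (proj₂ (occurrence-dominates m-inRange m≢i₁ m≢i₂))))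

nothing-between-0-and-1 : ∀ {a} → 0 < a → ¬ a < 1
nothing-between-0-and-1 (s≤s z≤n) (s≤s ())

startsWithOne⇒occurrence : ∀ {σ i₂} → IsPerm σ → T (startsWithOne σ) → InRange (length σ) i₂ → 1 < i₂ →
                           T (isOcc meshR σ 1 i₂)
startsWithOne⇒occurrence {σ@(suc zero ∷ w)} {i₂} perm _ i₂-inRange 1<i₂ =
  isOcc-intro meshR σ 1<i₂ 1<v₂ (column-0 0 ∷ column-0 1 ∷ column-0 2 ∷ row-0 1 ∷ row-0 2 ∷ [])
  where
  open IsPerm perm
  1<v₂ : 1 < at σ i₂
  1<v₂ = ≤∧≢⇒< (proj₁ (All.lookup inRange (at-∈ σ i₂-inRange)))
               (<⇒≢ 1<i₂ ∘ at-injective σ isDistinct (s≤s z≤n , s≤s z≤n) i₂-inRange)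
  column-0 : ∀ y → T (boxEmpty σ 1 i₂ (0 , y))
  column-0 y = boxEmpty-intro σ 1 i₂ (0 , y) λ _ ((0<m , m<1) , _) → nothing-between-0-and-1 0<m m<1
  row-0 : ∀ x → T (boxEmpty σ 1 i₂ (x , 0))
  row-0 x = boxEmpty-intro σ 1 i₂ (x , 0) λ _ (_ , (0<v , v<1)) → nothing-between-0-and-1 0<v v<1

isOcc-meshR : ∀ {σ i₁ i₂} → IsPerm σ → InRange (length σ) i₁ → InRange (length σ) i₂ →
              isOcc meshR σ i₁ i₂ ≡ startsWithOne σ ∧ ((i₁ ≡ᵇ 1) ∧ (1 <ᵇ i₂))
isOcc-meshR {σ} {i₁} {i₂} perm i₁-inRange i₂-inRange = T-ext forward backward
  where
  forward : T (isOcc meshR σ i₁ i₂) → T (startsWithOne σ ∧ ((i₁ ≡ᵇ 1) ∧ (1 <ᵇ i₂)))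
  forward occ with occurrence⇒i₁≡1 perm i₁-inRange i₂-inRange occ
  ... | refl = Equivalence.from (T-∧ {startsWithOne σ})
    ( at-1≡1⇒startsWithOne σ (occurrence⇒at-i₁≡1 perm i₁-inRange i₂-inRange occ)
    , Equivalence.from (T-∧ {true}) (_ , <⇒<ᵇ (proj₁ (isOcc-elim meshR σ {1} {i₂} occ))) )
  backward : T (startsWithOne σ ∧ ((i₁ ≡ᵇ 1) ∧ (1 <ᵇ i₂))) → T (isOcc meshR σ i₁ i₂)
  backward t with Equivalence.to (T-∧ {startsWithOne σ}) t
  ... | starts , rest with Equivalence.to (T-∧ {i₁ ≡ᵇ 1}) rest
  ...   | i₁≡ᵇ1 , 1<ᵇi₂ with ≡ᵇ⇒≡ i₁ 1 i₁≡ᵇ1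
  ...     | refl = startsWithOne⇒occurrence perm starts i₂-inRange (<ᵇ⇒< 1 i₂ 1<ᵇi₂)

count-pairs-from-1 : ∀ s N → sum (map (λ i → count (λ j → s ∧ ((i ≡ᵇ 1) ∧ (1 <ᵇ j))) (range N)) (range N))
                              ≡ (if s then N ∸ 1 else 0)
count-pairs-from-1 false N       =
  sum-map-zero (All.universal (λ _ → count-none (λ _ → false) {range N} (All.universal (λ _ ()) (range N))) (range N))
count-pairs-from-1 true  zero    = refl
count-pairs-from-1 true  (suc L) = begin
  sum (map row (range (suc L)))
    ≡⟨ cong (λ r → sum (map (λ i → count (λ j → (i ≡ᵇ 1) ∧ (1 <ᵇ j)) r) r)) (range-suc L) ⟩
  count (1 <ᵇ_) (map suc (range L)) + sum (map row′ (map suc (range L)))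
    ≡⟨ cong₂ _+_ (count-all (map⁺ (All.map first-row (range-inRange L))))
                 (sum-map-zero (map⁺ (All.map later-row (range-inRange L)))) ⟩
  length (map suc (range L)) + 0
    ≡⟨ +-identityʳ _ ⟩
  length (map suc (range L))
    ≡⟨ trans (length-map suc (range L)) (length-range L) ⟩
  L ∎
  where
  open ≡-Reasoning
  row row′ : ℕ → ℕ
  row i = count (λ j → (i ≡ᵇ 1) ∧ (1 <ᵇ j)) (range (suc L))
  row′ i = count (λ j → (i ≡ᵇ 1) ∧ (1 <ᵇ j)) (1 ∷ map suc (range L))
  first-row : ∀ {j} → InRange L j → T (1 <ᵇ suc j)
  first-row {suc j} _ = _
  later-row : ∀ {i} → InRange L i → row′ (suc i) ≡ 0
  later-row {suc i} _ = count-none (λ _ → false) {1 ∷ map suc (range L)} (All.universal (λ _ ()) _)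

pocc-perm : ∀ {σ} → IsPerm σ → pocc σ ≡ (if startsWithOne σ then length σ ∸ 1 else 0)
pocc-perm {σ} perm = begin
  pocc σ
    ≡⟨ sum-map-cong (All.map (λ i₁-inRange → count-cong (All.map (isOcc-meshR perm i₁-inRange) (range-inRange N)))
                             (range-inRange N)) ⟩
  sum (map (λ i₁ → count (λ i₂ → startsWithOne σ ∧ ((i₁ ≡ᵇ 1) ∧ (1 <ᵇ i₂))) (range N)) (range N))
    ≡⟨ count-pairs-from-1 (startsWithOne σ) N ⟩
  (if startsWithOne σ then N ∸ 1 else 0) ∎
  where
  open ≡-Reasoning
  N = length σ

any-map-suc : ∀ x w → any (suc x ≡ᵇ_) (map suc w) ≡ any (x ≡ᵇ_) w
any-map-suc x w = cong or (sym (map-∘ w))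

distinct-map-suc : ∀ w → distinct (map suc w) ≡ distinct w
distinct-map-suc []      = refl
distinct-map-suc (x ∷ w) = cong₂ (λ a b → not a ∧ b) (any-map-suc x w) (distinct-map-suc w)

isKing-map-suc : ∀ w → isKing (map suc w) ≡ isKing w
isKing-map-suc []          = refl
isKing-map-suc (x ∷ [])    = refl
isKing-map-suc (x ∷ y ∷ w) = cong ((1 <ᵇ ∣ x - y ∣) ∧_) (isKing-map-suc (y ∷ w))

1∉map-suc : ∀ {n w} → All (InRange n) w → any (1 ≡ᵇ_) (map suc w) ≡ false
1∉map-suc []                       = refl
1∉map-suc {w = suc _ ∷ _} (_ ∷ inR) = 1∉map-suc inR

isKing-1∷map-suc : ∀ {n w} → All (InRange n) w → isKing (1 ∷ map suc w) ≡ isKing w ∧ not (startsWithOne w)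
isKing-1∷map-suc {w = []}              []  = refl
isKing-1∷map-suc {w = zero ∷ w}        ((() , _) ∷ _)
isKing-1∷map-suc {w = suc zero ∷ w}    _   = sym (∧-zeroʳ _)
isKing-1∷map-suc {w = suc (suc y) ∷ w} _   = trans (isKing-map-suc (suc (suc y) ∷ w)) (sym (∧-identityʳ _))

distinct∧isKing-1∷map-suc : ∀ {n w} → All (InRange n) w →
  distinct (1 ∷ map suc w) ∧ isKing (1 ∷ map suc w) ≡ distinct w ∧ (isKing w ∧ not (startsWithOne w))
distinct∧isKing-1∷map-suc {w = w} inR =
  cong₂ _∧_ (cong₂ (λ a b → not a ∧ b) (1∉map-suc inR) (distinct-map-suc w)) (isKing-1∷map-suc inR)

count-kings-startsWithOne-suc : ∀ n → count startsWithOne (kings (suc n)) ≡ count (not ∘ startsWithOne) (kings n)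
count-kings-startsWithOne-suc n = begin
  count startsWithOne (kings (suc n))
    ≡⟨ count-kings (suc n) startsWithOne ⟩
  count good (words (suc n) (suc n))
    ≡⟨ count-as-sum good (words (suc n) (suc n)) ⟩
  sum (map (indicator ∘ good) (words (suc n) (suc n)))
    ≡⟨ sum-map-concatMap (indicator ∘ good) (λ w → map (_∷ w) (range (suc n))) (words n (suc n)) ⟩
  sum (map (λ w → sum (map (indicator ∘ good) (map (_∷ w) (range (suc n))))) (words n (suc n)))
    ≡⟨ sum-map-cong (All.universal first-letter-one (words n (suc n))) ⟩
  sum (map (λ w → indicator (distinct (1 ∷ w) ∧ isKing (1 ∷ w))) (words n (suc n)))
    ≡⟨ sum-words-suc n n _ contains-one ⟩
  sum (map (λ w → indicator (distinct (1 ∷ map suc w) ∧ isKing (1 ∷ map suc w))) (words n n))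
    ≡⟨ sum-map-cong (All.map (cong indicator ∘ distinct∧isKing-1∷map-suc ∘ proj₂) (words-inRange n n)) ⟩
  sum (map (indicator ∘ λ w → distinct w ∧ (isKing w ∧ not (startsWithOne w))) (words n n))
    ≡⟨ count-as-sum _ (words n n) ⟨
  count (λ w → distinct w ∧ (isKing w ∧ not (startsWithOne w))) (words n n)
    ≡⟨ count-kings n (not ∘ startsWithOne) ⟨
  count (not ∘ startsWithOne) (kings n) ∎
  where
  open ≡-Reasoning
  good : List ℕ → Bool
  good w = distinct w ∧ (isKing w ∧ startsWithOne w)
  later-letter : ∀ {a} w → InRange n a → indicator (good (suc a ∷ w)) ≡ 0
  later-letter {suc a} w _ = cong indicator
    (trans (cong (distinct (suc (suc a) ∷ w) ∧_) (∧-zeroʳ (isKing (suc (suc a) ∷ w)))) (∧-zeroʳ _))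
  first-letter-one : ∀ w → sum (map (indicator ∘ good) (map (_∷ w) (range (suc n))))
                           ≡ indicator (distinct (1 ∷ w) ∧ isKing (1 ∷ w))
  first-letter-one w = begin
    sum (map (indicator ∘ good) (map (_∷ w) (range (suc n))))
      ≡⟨ cong (λ r → sum (map (indicator ∘ good) (map (_∷ w) r))) (range-suc n) ⟩
    indicator (good (1 ∷ w)) + sum (map (indicator ∘ good) (map (_∷ w) (map suc (range n))))
      ≡⟨ cong₂ _+_ (cong (λ b → indicator (distinct (1 ∷ w) ∧ b)) (∧-identityʳ _))
                   (sum-map-zero (map⁺ (map⁺ (All.map (later-letter w) (range-inRange n))))) ⟩
    indicator (distinct (1 ∷ w) ∧ isKing (1 ∷ w)) + 0
      ≡⟨ +-identityʳ _ ⟩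
    indicator (distinct (1 ∷ w) ∧ isKing (1 ∷ w)) ∎
  contains-one : ∀ w → T (any (1 ≡ᵇ_) w) → indicator (distinct (1 ∷ w) ∧ isKing (1 ∷ w)) ≡ 0
  contains-one w 1∈w rewrite Equivalence.to T-≡ 1∈w = refl

count-kings-pocc : ∀ n k → count (λ σ → pocc σ ≡ᵇ k) (kings n)
  ≡ (if k ≡ᵇ n ∸ 1 then count startsWithOne (kings n) else 0)
    + (if k ≡ᵇ 0 then count (not ∘ startsWithOne) (kings n) else 0)
count-kings-pocc n k =
  trans (count-cong (All.map pocc≡ᵇk (kings-isPerm n))) (count-if startsWithOne _ _ (kings n))
  where
  pocc≡ᵇk : ∀ {σ} → length σ ≡ n × IsPerm σ →
            (pocc σ ≡ᵇ k) ≡ (if startsWithOne σ then (k ≡ᵇ n ∸ 1) else (k ≡ᵇ 0))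
  pocc≡ᵇk {σ} (refl , perm) rewrite pocc-perm perm with startsWithOne σ
  ... | true  = ≡ᵇ-sym (length σ ∸ 1) k
  ... | false = ≡ᵇ-sym 0 k

pos-if : ∀ b {m x} → + m ≡ x → + (if b then m else 0) ≡ (if b then x else 0ℤ)
pos-if true  eq = eq
pos-if false _  = refl

count-kings-not-startsWithOne≡A⊛inv1+t : ∀ n → + count (not ∘ startsWithOne) (kings n) ≡ (A ⊛ inv1+t) n
count-kings-not-startsWithOne≡A⊛inv1+t = ⊛-inv1+t-unique (λ n → + c n) A refl c[1+t]≡A
  where
  c : ℕ → ℕ
  c n = count (not ∘ startsWithOne) (kings n)
  c[1+t]≡A : ∀ n → + c n ℤ.+ + c (suc n) ≡ A (suc n)
  c[1+t]≡A n = trans (sym (ℤP.pos-+ (c n) (c (suc n))))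
    (cong +_ (trans (cong (_+ c (suc n)) (sym (count-kings-startsWithOne-suc n)))
                    (count-complement startsWithOne (kings (suc n)))))

count-kings-startsWithOne≡tA[ut]⊛inv1+ut : ∀ n k → + (if k ≡ᵇ n ∸ 1 then count startsWithOne (kings n) else 0)
                                    ≡ ((lift tS ⊛₂ subst-ut A) ⊛₂ subst-ut inv1+t) n k
count-kings-startsWithOne≡tA[ut]⊛inv1+ut zero    zero    = sym (lift-tS-⊛₂-⊛₂-zero (subst-ut A) (subst-ut inv1+t) 0)
count-kings-startsWithOne≡tA[ut]⊛inv1+ut zero    (suc k) = sym (lift-tS-⊛₂-⊛₂-zero (subst-ut A) (subst-ut inv1+t) (suc k))
count-kings-startsWithOne≡tA[ut]⊛inv1+ut (suc n) k = begin
  + (if k ≡ᵇ n then count startsWithOne (kings (suc n)) else 0)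
    ≡⟨ pos-if (k ≡ᵇ n) (trans (cong +_ (count-kings-startsWithOne-suc n)) (count-kings-not-startsWithOne≡A⊛inv1+t n)) ⟩
  subst-ut (A ⊛ inv1+t) n k
    ≡⟨ subst-ut-⊛₂ A inv1+t n k ⟨
  (subst-ut A ⊛₂ subst-ut inv1+t) n k
    ≡⟨ lift-tS-⊛₂-⊛₂-suc (subst-ut A) (subst-ut inv1+t) n k ⟨
  ((lift tS ⊛₂ subst-ut A) ⊛₂ subst-ut inv1+t) (suc n) k ∎
  where open ≡-Reasoning

E-formula : ∀ n k → E n k ≡ (lift (A ⊛ inv1+t) ⊕₂ ((lift tS ⊛₂ subst-ut A) ⊛₂ subst-ut inv1+t)) n k
E-formula n k = begin
  E n k
    ≡⟨ cong +_ (count-kings-pocc n k) ⟩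
  + (from-one + not-from-one)
    ≡⟨ ℤP.pos-+ from-one not-from-one ⟩
  + from-one ℤ.+ + not-from-one
    ≡⟨ ℤP.+-comm (+ from-one) (+ not-from-one) ⟩
  + not-from-one ℤ.+ + from-one
    ≡⟨ cong₂ ℤ._+_ (pos-if (k ≡ᵇ 0) (count-kings-not-startsWithOne≡A⊛inv1+t n)) (count-kings-startsWithOne≡tA[ut]⊛inv1+ut n k) ⟩
  (lift (A ⊛ inv1+t) ⊕₂ ((lift tS ⊛₂ subst-ut A) ⊛₂ subst-ut inv1+t)) n k ∎
  where
  open ≡-Reasoning
  from-one not-from-one : ℕ
  from-one     = if k ≡ᵇ n ∸ 1 then count startsWithOne (kings n) else 0
  not-from-one = if k ≡ᵇ 0 then count (not ∘ startsWithOne) (kings n) else 0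

tA[ut]⊛inv1+ut-at-u⁰ : ∀ n → ((lift tS ⊛₂ subst-ut A) ⊛₂ subst-ut inv1+t) n 0 ≡ tS n
tA[ut]⊛inv1+ut-at-u⁰ zero    = lift-tS-⊛₂-⊛₂-zero (subst-ut A) (subst-ut inv1+t) 0
tA[ut]⊛inv1+ut-at-u⁰ (suc n) = trans (lift-tS-⊛₂-⊛₂-suc (subst-ut A) (subst-ut inv1+t) n 0)
                             (trans (subst-ut-⊛₂ A inv1+t n 0) (constant-term n))
  where
  constant-term : ∀ n → subst-ut (A ⊛ inv1+t) n 0 ≡ tS (suc n)
  constant-term zero    = refl
  constant-term (suc n) = refl

P-formula : ∀ n → P n ≡ (tS ⊕ (A ⊛ inv1+t)) n
P-formula n = begin
  P n
    ≡⟨ E-formula n 0 ⟩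
  (A ⊛ inv1+t) n ℤ.+ ((lift tS ⊛₂ subst-ut A) ⊛₂ subst-ut inv1+t) n 0
    ≡⟨ cong (λ x → (A ⊛ inv1+t) n ℤ.+ x) (tA[ut]⊛inv1+ut-at-u⁰ n) ⟩
  (A ⊛ inv1+t) n ℤ.+ tS n
    ≡⟨ ℤP.+-comm ((A ⊛ inv1+t) n) (tS n) ⟩
  (tS ⊕ (A ⊛ inv1+t)) n ∎
  where open ≡-Reasoning

theorem3p3 : ((n : ℕ) → P n ≡ (tS ⊕ (A ⊛ inv1+t)) n)
    × ((n k : ℕ) → E n k ≡ (lift (A ⊛ inv1+t) ⊕₂ ((lift tS ⊛₂ subst-ut A) ⊛₂ subst-ut inv1+t)) n k)
theorem3p3 = P-formula , E-formula
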